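{- Let $\Gamma$ be a simple graph on a finite set $X$ with $|X|=n\geq 3$, and $G=G(\Gamma)$. 1. $G$ acts transitively on $X$ if and only if the localized graphs ${}^x\Gamma$, $x\in X$, are pairwise isomorphic. 2. If $G$ acts doubly transitively on $X$, then for any $x\in X$ the automorphism group $\mathrm{Aut}({}^x\Gamma)$ acts transitively on $X\setminus\{x\}$. 3. If for two distinct points $x,y\in X$ the groups $\mathrm{Aut}({}^x\Gamma)$ and $\mathrm{Aut}({}^y\Gamma)$ act transitively on $X\setminus\{x\}$ and $X\setminus\{y\}$ respectively, then $G$ acts doubly transitively on $X$.
   Context: The matrix of a simple graph on $X$ is $\mathcal{E}=(\varepsilon_{i,j})$ with $\varepsilon_{i,j}=-1$ if $i\neq j$ are adjacent and $1$ otherwise. Graphs with matrices $\mathcal{E}=(\varepsilon_{i,j})$, $\mathcal{E}'=(\varepsilon'_{i,j})$ are associated if there exist $\nu_i\in\{ -1,1\}$ with $\varepsilon'_{i,j}=\nu_i\nu_j\varepsilon_{i,j}$ for all $i,j$. For a permutation $\sigma$ of $X$, ${}^\sigma\Gamma$ is the image graph, with matrix $({}^\sigma\mathcal{E})_{i,j}=\mathcal{E}_{\sigma^{ -1}(i),\sigma^{ -1}(j)}$. $G(\Gamma)$ is the group of permutations $\sigma$ of $X$ such that $\Gamma$ and ${}^\sigma\Gamma$ are associated. For $x\in X$, the localized graph ${}^x\Gamma$ is the unique graph associated to $\Gamma$ in which $x$ is an isolated vertex. -}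

module Defs where

open import Data.Nat using (ℕ)
open import Data.Bool using (Bool; true; false; _xor_; if_then_else_)
open import Data.Fin using (Fin)
open import Data.Fin.Permutation using (Permutation′; _⟨$⟩ʳ_; _⟨$⟩ˡ_)
open import Data.Sign using (Sign; +; -; _*_)
open import Data.Product using (Σ; _×_; _,_)
open import Relation.Binary.PropositionalEquality using (_≡_; refl; trans; cong)
open import Relation.Nullary using (¬_)

record SimpleGraph (n : ℕ) : Set where
  field
    adj    : Fin n → Fin n → Bool
    sym    : ∀ i j → adj i j ≡ adj j i
    irrefl : ∀ i → adj i i ≡ false
open SimpleGraph public

-- The (±1)-matrix of a graph: -1 if i ≠ j adjacent, +1 otherwise
-- (the diagonal is +1 because the graph is irreflexive).
matrix : ∀ {n} → SimpleGraph n → Fin n → Fin n → Sign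
matrix Γ i j = if adj Γ i j then - else +

Associated : ∀ {n} → SimpleGraph n → SimpleGraph n → Set
Associated {n} Γ Δ =
  Σ (Fin n → Sign) λ ν → ∀ i j → matrix Δ i j ≡ (ν i * ν j) * matrix Γ i j

image : ∀ {n} → Permutation′ n → SimpleGraph n → SimpleGraph n
image σ Γ = record
  { adj    = λ i j → adj Γ (σ ⟨$⟩ˡ i) (σ ⟨$⟩ˡ j)
  ; sym    = λ i j → sym Γ (σ ⟨$⟩ˡ i) (σ ⟨$⟩ˡ j)
  ; irrefl = λ i → irrefl Γ (σ ⟨$⟩ˡ i)
  }

InG : ∀ {n} → SimpleGraph n → Permutation′ n → Set
InG Γ σ = Associated Γ (image σ Γ)

SameGraph : ∀ {n} → SimpleGraph n → SimpleGraph n → Set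
SameGraph Γ Δ = ∀ i j → adj Γ i j ≡ adj Δ i j

InAut : ∀ {n} → SimpleGraph n → Permutation′ n → Set
InAut Γ σ = SameGraph (image σ Γ) Γ

Isomorphic : ∀ {n} → SimpleGraph n → SimpleGraph n → Set
Isomorphic {n} Γ Δ = Σ (Permutation′ n) λ σ → SameGraph (image σ Γ) Δ

private
  xor-swap : ∀ a b c → (a xor b) xor c ≡ (a xor c) xor b
  xor-swap true  true  true  = refl
  xor-swap true  true  false = refl
  xor-swap true  false true  = refl
  xor-swap true  false false = refl
  xor-swap false true  true  = refl
  xor-swap false true  false = refl
  xor-swap false false true  = refl
  xor-swap false false false = refl

  xor-self : ∀ a → (false xor a) xor a ≡ false
  xor-self true  = refl
  xor-self false = refl

  cong-xor : ∀ {a a'} b c → a ≡ a' → (a xor b) xor c ≡ (a' xor b) xor c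
  cong-xor b c refl = refl

-- Localized graph ^xΓ: switching Γ with respect to the neighbourhood of x
-- (ν_i = -1 iff i is adjacent to x).  This is the unique graph associated
-- to Γ in which x is isolated.
localized : ∀ {n} → SimpleGraph n → Fin n → SimpleGraph n
localized Γ x = record
  { adj    = λ i j → (adj Γ i j xor adj Γ x i) xor adj Γ x j
  ; sym    = λ i j → trans (cong-xor (adj Γ x i) (adj Γ x j) (sym Γ i j))
                           (xor-swap (adj Γ j i) (adj Γ x i) (adj Γ x j))
  ; irrefl = λ i → trans (cong-xor (adj Γ x i) (adj Γ x i) (irrefl Γ i))
                         (xor-self (adj Γ x i))
  }

GTransitive : ∀ {n} → SimpleGraph n → Set
GTransitive {n} Γ =
  ∀ (x y : Fin n) → Σ (Permutation′ n) λ σ → InG Γ σ × σ ⟨$⟩ʳ x ≡ y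

GDoublyTransitive : ∀ {n} → SimpleGraph n → Set
GDoublyTransitive {n} Γ =
  ∀ (x₁ x₂ y₁ y₂ : Fin n) → ¬ x₁ ≡ x₂ → ¬ y₁ ≡ y₂ →
  Σ (Permutation′ n) λ σ → InG Γ σ × σ ⟨$⟩ʳ x₁ ≡ y₁ × σ ⟨$⟩ʳ x₂ ≡ y₂

-- Aut(Δ) acts transitively on X ∖ {x}: for y, z ≠ x there is an
-- automorphism fixing x (so acting on X ∖ {x}) sending y to z.
AutTransitiveOff : ∀ {n} → SimpleGraph n → Fin n → Set
AutTransitiveOff {n} Δ x =
  ∀ (y z : Fin n) → ¬ y ≡ x → ¬ z ≡ x →
  Σ (Permutation′ n) λ σ → InAut Δ σ × σ ⟨$⟩ʳ x ≡ x × σ ⟨$⟩ʳ y ≡ z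

-- The localized graph ^xΓ is the unique representative of the switching class of Γ
-- in which x is isolated.  Hence σ ∈ G(Γ) exactly when σ maps ^xΓ onto ^(σx)Γ, for
-- one (equivalently every) x; in particular the stabilizer of x in G(Γ) is
-- Aut(^xΓ).  Part 1 follows, because two isolated vertices of ^yΓ may be swapped
-- by an automorphism; part 2 is the stabilizer statement; for part 3, the
-- stabilizers of x and y move every point to x, so G(Γ) is transitive with
-- point stabilizer transitive on the remaining points.
module Submission where

open import Defs renaming (sym to adj-sym)
open import Data.Bool using (Bool; true; false; _xor_; if_then_else_)
open import Data.Bool.Properties using (xor-identityʳ; xor-same)
open import Data.Fin using (Fin; zero; suc)
open import Data.Fin.Permutation
  using (Permutation′; _⟨$⟩ʳ_; _⟨$⟩ˡ_; _∘ₚ_; id; flip; transpose; inverseˡ)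
import Data.Fin.Permutation.Components as Components
open import Data.Fin.Properties using (_≟_)
open import Data.Nat using (ℕ; _≤_; s≤s)
open import Data.Product using (Σ; _×_; _,_)
open import Data.Sign using (Sign; +; -; _*_)
open import Data.Sign.Properties using (*-assoc; s*s≡+; *-commutativeSemigroup; *-group)
open import Algebra.Properties.CommutativeSemigroup *-commutativeSemigroup
  using (interchange; xy∙z≈yz∙x)
open import Algebra.Properties.Group *-group using (inverseʳ-unique)
open import Data.Sum using (_⊎_; inj₁; inj₂)
open import Function.Bundles using (_⇔_; mk⇔; Injection)
open import Function.Properties.Inverse using (↔⇒↣)
open import Level using (0ℓ)
open import Relation.Binary.Bundles using (Setoid)
open import Relation.Binary.PropositionalEquality
  using (_≡_; _≢_; ≢-sym; refl; sym; trans; cong; cong₂; subst; module ≡-Reasoning)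
import Relation.Binary.Reasoning.Setoid as SetoidReasoning
open import Relation.Nullary using (¬_; yes; no)
open import Relation.Nullary.Negation using (contradiction)

private
  variable
    n : ℕ

sign : Bool → Sign
sign b = if b then - else +

sign-xor : ∀ a b → sign (a xor b) ≡ sign a * sign b
sign-xor false b     = refl
sign-xor true  false = refl
sign-xor true  true  = refl

sign-injective : ∀ {a b} → sign a ≡ sign b → a ≡ b
sign-injective {false} {false} _ = refl
sign-injective {true}  {true}  _ = refl

*-cancelˡ-self : ∀ s t → s * (s * t) ≡ t
*-cancelˡ-self s t = trans (sym (*-assoc s s t)) (cong (_* t) (s*s≡+ s))

matrix-localized : (Γ : SimpleGraph n) (x i j : Fin n) →
  matrix (localized Γ x) i j ≡ (matrix Γ x i * matrix Γ x j) * matrix Γ i j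
matrix-localized Γ x i j = begin
  sign ((adj Γ i j xor adj Γ x i) xor adj Γ x j)
    ≡⟨ trans (sign-xor (adj Γ i j xor adj Γ x i) (adj Γ x j))
         (cong (_* matrix Γ x j) (sign-xor (adj Γ i j) (adj Γ x i))) ⟩
  (matrix Γ i j * matrix Γ x i) * matrix Γ x j
    ≡⟨ xy∙z≈yz∙x (matrix Γ i j) (matrix Γ x i) (matrix Γ x j) ⟩
  (matrix Γ x i * matrix Γ x j) * matrix Γ i j ∎
  where open ≡-Reasoning

Associated-refl : (Γ : SimpleGraph n) → Associated Γ Γ
Associated-refl Γ = (λ _ → +) , λ _ _ → refl

Associated-sym : {Γ Δ : SimpleGraph n} → Associated Γ Δ → Associated Δ Γ
Associated-sym {Γ = Γ} (ν , e) = ν , λ i j →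
  trans (sym (*-cancelˡ-self (ν i * ν j) (matrix Γ i j))) (cong (ν i * ν j *_) (sym (e i j)))

Associated-trans : {Γ Δ Θ : SimpleGraph n} → Associated Γ Δ → Associated Δ Θ → Associated Γ Θ
Associated-trans {Γ = Γ} {Θ = Θ} (ν , e) (μ , f) = (λ i → μ i * ν i) , composite
  where
  open ≡-Reasoning
  composite : ∀ i j → matrix Θ i j ≡ ((μ i * ν i) * (μ j * ν j)) * matrix Γ i j
  composite i j = begin
    matrix Θ i j                      ≡⟨ f i j ⟩
    (μ i * μ j) * _                   ≡⟨ cong (μ i * μ j *_) (e i j) ⟩
    (μ i * μ j) * ((ν i * ν j) * m)   ≡⟨ sym (*-assoc (μ i * μ j) _ m) ⟩
    ((μ i * μ j) * (ν i * ν j)) * m   ≡⟨ cong (_* m) (interchange (μ i) (μ j) (ν i) (ν j)) ⟩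
    ((μ i * ν i) * (μ j * ν j)) * m   ∎
    where m = matrix Γ i j

SameGraph⇒Associated : {Δ Δ′ : SimpleGraph n} → SameGraph Δ Δ′ → Associated Δ Δ′
SameGraph⇒Associated same = (λ _ → +) , λ i j → cong sign (sym (same i j))

associated-setoid : ℕ → Setoid 0ℓ 0ℓ
associated-setoid n = record
  { Carrier       = SimpleGraph n
  ; _≈_           = Associated
  ; isEquivalence = record
    { refl  = λ {Γ} → Associated-refl Γ
    ; sym   = λ {Γ} {Δ} → Associated-sym {Γ = Γ} {Δ}
    ; trans = λ {Γ} {Δ} {Θ} → Associated-trans {Γ = Γ} {Δ} {Θ}
    }
  }

Associated-image : (σ : Permutation′ n) {Γ Δ : SimpleGraph n} →
  Associated Γ Δ → Associated (image σ Γ) (image σ Δ)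
Associated-image σ (ν , e) = (λ i → ν (σ ⟨$⟩ˡ i)) , λ i j → e _ _

Associated-localized : (Γ : SimpleGraph n) (x : Fin n) → Associated Γ (localized Γ x)
Associated-localized Γ x = matrix Γ x , matrix-localized Γ x

Isolated : SimpleGraph n → Fin n → Set
Isolated Δ x = ∀ j → adj Δ x j ≡ false

isolatedʳ : (Δ : SimpleGraph n) {x : Fin n} → Isolated Δ x → ∀ j → adj Δ j x ≡ false
isolatedʳ Δ {x} iso j = trans (adj-sym Δ j x) (iso j)

Isolated-image : (σ : Permutation′ n) {Δ : SimpleGraph n} {x : Fin n} →
  Isolated Δ x → Isolated (image σ Δ) (σ ⟨$⟩ʳ x)
Isolated-image σ {Δ} {x} iso j =
  subst (λ y → adj Δ y (σ ⟨$⟩ˡ j) ≡ false) (sym (inverseˡ σ)) (iso (σ ⟨$⟩ˡ j))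

isolated-localized : (Γ : SimpleGraph n) (x : Fin n) → Isolated (localized Γ x) x
isolated-localized Γ x j = begin
  (adj Γ x j xor adj Γ x x) xor adj Γ x j ≡⟨ cong (λ b → (adj Γ x j xor b) xor adj Γ x j) (irrefl Γ x) ⟩
  (adj Γ x j xor false) xor adj Γ x j     ≡⟨ cong (_xor adj Γ x j) (xor-identityʳ (adj Γ x j)) ⟩
  adj Γ x j xor adj Γ x j                 ≡⟨ xor-same (adj Γ x j) ⟩
  false                                   ∎
  where open ≡-Reasoning

-- The switching signs are pinned down by the row of x, up to the irrelevant global sign ν x.
localized-unique : {Γ Δ : SimpleGraph n} (x : Fin n) →
  Associated Γ Δ → Isolated Δ x → SameGraph Δ (localized Γ x)
localized-unique {Γ = Γ} {Δ} x (ν , e) iso i j =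
  sign-injective (begin
    matrix Δ i j                                  ≡⟨ e i j ⟩
    (ν i * ν j) * matrix Γ i j                    ≡⟨ cong (_* matrix Γ i j) (signs i j) ⟩
    (matrix Γ x i * matrix Γ x j) * matrix Γ i j  ≡⟨ sym (matrix-localized Γ x i j) ⟩
    matrix (localized Γ x) i j                    ∎)
  where
  open ≡-Reasoning
  ν-row : ∀ k → ν k ≡ ν x * matrix Γ x k
  ν-row k = begin
    ν k                    ≡⟨ sym (*-cancelˡ-self (ν x) (ν k)) ⟩
    ν x * (ν x * ν k)      ≡⟨ cong (ν x *_) (sym (inverseʳ-unique (ν x * ν k) (matrix Γ x k)
                                (trans (sym (e x k)) (cong sign (iso k))))) ⟩
    ν x * matrix Γ x k     ∎
  signs : ∀ i j → ν i * ν j ≡ matrix Γ x i * matrix Γ x j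
  signs i j = begin
    ν i * ν j                                        ≡⟨ cong₂ _*_ (ν-row i) (ν-row j) ⟩
    (ν x * matrix Γ x i) * (ν x * matrix Γ x j)      ≡⟨ interchange (ν x) _ (ν x) _ ⟩
    (ν x * ν x) * (matrix Γ x i * matrix Γ x j)      ≡⟨ cong (_* _) (s*s≡+ (ν x)) ⟩
    matrix Γ x i * matrix Γ x j                      ∎

InG-id : (Γ : SimpleGraph n) → InG Γ id
InG-id = Associated-refl

InG-∘ : (Γ : SimpleGraph n) (τ π : Permutation′ n) → InG Γ τ → InG Γ π → InG Γ (τ ∘ₚ π)
InG-∘ {n} Γ τ π hτ hπ = begin
  Γ                    ≈⟨ hπ ⟩
  image π Γ            ≈⟨ Associated-image π {Γ} {image τ Γ} hτ ⟩
  image π (image τ Γ)  ∎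
  where open SetoidReasoning (associated-setoid n)

InG-flip : (Γ : SimpleGraph n) (σ : Permutation′ n) → InG Γ σ → InG Γ (flip σ)
InG-flip {n} Γ σ h = begin
  Γ                           ≈⟨ SameGraph⇒Associated {Δ = image (flip σ) (image σ Γ)} {Γ} cancel ⟨
  image (flip σ) (image σ Γ)  ≈⟨ Associated-image (flip σ) {Γ} {image σ Γ} h ⟨
  image (flip σ) Γ            ∎
  where
  open SetoidReasoning (associated-setoid n)
  cancel : SameGraph (image (flip σ) (image σ Γ)) Γ
  cancel i j = cong₂ (adj Γ) (inverseˡ σ) (inverseˡ σ)

InG⇒image-localized : (Γ : SimpleGraph n) (σ : Permutation′ n) (x : Fin n) →
  InG Γ σ → SameGraph (image σ (localized Γ x)) (localized Γ (σ ⟨$⟩ʳ x))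
InG⇒image-localized {n} Γ σ x h =
  localized-unique {Γ = Γ} {image σ (localized Γ x)} (σ ⟨$⟩ʳ x) switching
    (Isolated-image σ {localized Γ x} (isolated-localized Γ x))
  where
  open SetoidReasoning (associated-setoid n)
  switching : Associated Γ (image σ (localized Γ x))
  switching = begin
    Γ                        ≈⟨ h ⟩
    image σ Γ                ≈⟨ Associated-image σ {Γ} {localized Γ x} (Associated-localized Γ x) ⟩
    image σ (localized Γ x)  ∎

image-localized⇒InG : (Γ : SimpleGraph n) (σ : Permutation′ n) (x y : Fin n) →
  SameGraph (image σ (localized Γ x)) (localized Γ y) → InG Γ σ
image-localized⇒InG {n} Γ σ x y same = begin
  Γ                        ≈⟨ Associated-localized Γ y ⟩
  localized Γ y            ≈⟨ SameGraph⇒Associated {Δ = image σ (localized Γ x)} {localized Γ y} same ⟨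
  image σ (localized Γ x)  ≈⟨ Associated-image σ {Γ} {localized Γ x} (Associated-localized Γ x) ⟨
  image σ Γ                ∎
  where open SetoidReasoning (associated-setoid n)

InAut-localized⇒InG : (Γ : SimpleGraph n) (σ : Permutation′ n) (x : Fin n) →
  InAut (localized Γ x) σ → InG Γ σ
InAut-localized⇒InG Γ σ x = image-localized⇒InG Γ σ x x

InG-stabilizer⇒InAut : (Γ : SimpleGraph n) (σ : Permutation′ n) (x : Fin n) →
  InG Γ σ → σ ⟨$⟩ʳ x ≡ x → InAut (localized Γ x) σ
InG-stabilizer⇒InAut Γ σ x h σx≡x i j =
  trans (InG⇒image-localized Γ σ x h i j) (cong (λ z → adj (localized Γ z) i j) σx≡x)

transpose-fixes-or-swaps : (P : Fin n → Set) (u v : Fin n) → P u → P v →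
  ∀ k → Components.transpose u v k ≡ k ⊎ (P k × P (Components.transpose u v k))
transpose-fixes-or-swaps P u v pu pv k with k ≟ u
... | yes refl = inj₂ (pu , pv)
... | no _ with k ≟ v
...   | yes refl = inj₂ (pv , pu)
...   | no _     = inj₁ refl

transpose-mapsˡ : (u v : Fin n) → Components.transpose u v u ≡ v
transpose-mapsˡ u v with u ≟ u
... | yes _   = refl
... | no u≢u = contradiction refl u≢u

adj-preserved : (Δ : SimpleGraph n) (f : Fin n → Fin n) →
  (∀ k → f k ≡ k ⊎ (Isolated Δ k × Isolated Δ (f k))) →
  ∀ i j → adj Δ (f i) (f j) ≡ adj Δ i j
adj-preserved Δ f moves i j with moves i | moves j
... | inj₂ (iso-i , iso-fi) | _ = trans (iso-fi (f j)) (sym (iso-i j))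
... | inj₁ _ | inj₂ (iso-j , iso-fj) =
  trans (isolatedʳ Δ iso-fj (f i)) (sym (isolatedʳ Δ iso-j i))
... | inj₁ fi≡i | inj₁ fj≡j = cong₂ (adj Δ) fi≡i fj≡j

InAut-transpose : (Δ : SimpleGraph n) (u v : Fin n) →
  Isolated Δ u → Isolated Δ v → InAut Δ (transpose u v)
InAut-transpose Δ u v iso-u iso-v =
  adj-preserved Δ (Components.transpose v u)
    (transpose-fixes-or-swaps (Isolated Δ) v u iso-v iso-u)

transitive⇒localized-isomorphic : (Γ : SimpleGraph n) → GTransitive Γ →
  ∀ x y → Isomorphic (localized Γ x) (localized Γ y)
transitive⇒localized-isomorphic Γ transitive x y with transitive x y
... | σ , h , σx≡y = σ , λ i j →
  trans (InG⇒image-localized Γ σ x h i j) (cong (λ z → adj (localized Γ z) i j) σx≡y)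

-- An isomorphism τ : ^xΓ → ^yΓ need not send x to y, but τ x is isolated in ^yΓ,
-- so it can be corrected by the automorphism swapping τ x and y.
localized-isomorphic⇒transitive : (Γ : SimpleGraph n) →
  (∀ x y → Isomorphic (localized Γ x) (localized Γ y)) → GTransitive Γ
localized-isomorphic⇒transitive Γ isomorphic x y with isomorphic x y
... | τ , same = τ ∘ₚ transpose (τ ⟨$⟩ʳ x) y
               , image-localized⇒InG Γ (τ ∘ₚ transpose (τ ⟨$⟩ʳ x) y) x y corrected
               , transpose-mapsˡ (τ ⟨$⟩ʳ x) y
  where
  τx-isolated : Isolated (localized Γ y) (τ ⟨$⟩ʳ x)
  τx-isolated j = trans (sym (same (τ ⟨$⟩ʳ x) j))
    (Isolated-image τ {localized Γ x} (isolated-localized Γ x) j)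
  corrected : SameGraph (image (τ ∘ₚ transpose (τ ⟨$⟩ʳ x) y) (localized Γ x)) (localized Γ y)
  corrected i j = trans (same _ _)
    (InAut-transpose (localized Γ y) (τ ⟨$⟩ʳ x) y τx-isolated (isolated-localized Γ y) i j)

doublyTransitive⇒Aut-transitive : (Γ : SimpleGraph n) → GDoublyTransitive Γ →
  ∀ x → AutTransitiveOff (localized Γ x) x
doublyTransitive⇒Aut-transitive Γ doubly x y z y≢x z≢x
  with doubly x y x z (≢-sym y≢x) (≢-sym z≢x)
... | σ , h , σx≡x , σy≡z = σ , InG-stabilizer⇒InAut Γ σ x h σx≡x , σx≡x , σy≡z

third-point : 3 ≤ n → (x y : Fin n) → Σ (Fin n) λ c → c ≢ x × c ≢ y
third-point (s≤s (s≤s (s≤s _))) zero          zero          = suc zero , (λ ()) , (λ ())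
third-point (s≤s (s≤s (s≤s _))) zero          (suc zero)    = suc (suc zero) , (λ ()) , (λ ())
third-point (s≤s (s≤s (s≤s _))) zero          (suc (suc _)) = suc zero , (λ ()) , (λ ())
third-point (s≤s (s≤s (s≤s _))) (suc zero)    zero          = suc (suc zero) , (λ ()) , (λ ())
third-point (s≤s (s≤s (s≤s _))) (suc (suc _)) zero          = suc zero , (λ ()) , (λ ())
third-point (s≤s (s≤s (s≤s _))) (suc _)       (suc _)       = zero , (λ ()) , (λ ())

permute-≢ : (σ : Permutation′ n) {a b : Fin n} → a ≢ b → σ ⟨$⟩ʳ a ≢ σ ⟨$⟩ʳ b
permute-≢ σ a≢b σa≡σb = a≢b (Injection.injective (↔⇒↣ σ) σa≡σb)

doublyTransitive-by-stabilizer : (H : Permutation′ n → Set) →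
  (∀ τ π → H τ → H π → H (τ ∘ₚ π)) → (∀ σ → H σ → H (flip σ)) → (x : Fin n) →
  (∀ a → Σ (Permutation′ n) λ σ → H σ × σ ⟨$⟩ʳ a ≡ x) →
  (∀ y z → y ≢ x → z ≢ x → Σ (Permutation′ n) λ σ → H σ × σ ⟨$⟩ʳ x ≡ x × σ ⟨$⟩ʳ y ≡ z) →
  ∀ x₁ x₂ y₁ y₂ → x₁ ≢ x₂ → y₁ ≢ y₂ →
  Σ (Permutation′ n) λ σ → H σ × σ ⟨$⟩ʳ x₁ ≡ y₁ × σ ⟨$⟩ʳ x₂ ≡ y₂
doublyTransitive-by-stabilizer H H-∘ H-flip x to-x stabilizer x₁ x₂ y₁ y₂ x₁≢x₂ y₁≢y₂
  with to-x x₁ | to-x y₁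
... | α , hα , αx₁≡x | β , hβ , βy₁≡x
  with stabilizer (α ⟨$⟩ʳ x₂) (β ⟨$⟩ʳ y₂)
         (λ αx₂≡x → permute-≢ α x₁≢x₂ (trans αx₁≡x (sym αx₂≡x)))
         (λ βy₂≡x → permute-≢ β y₁≢y₂ (trans βy₁≡x (sym βy₂≡x)))
... | γ , hγ , γx≡x , γαx₂≡βy₂ =
  α ∘ₚ (γ ∘ₚ flip β) , H-∘ α (γ ∘ₚ flip β) hα (H-∘ γ (flip β) hγ (H-flip β hβ)) , maps₁ , maps₂
  where
  open ≡-Reasoning
  maps₁ : β ⟨$⟩ˡ (γ ⟨$⟩ʳ (α ⟨$⟩ʳ x₁)) ≡ y₁
  maps₁ = begin
    β ⟨$⟩ˡ (γ ⟨$⟩ʳ (α ⟨$⟩ʳ x₁))  ≡⟨ cong (λ a → β ⟨$⟩ˡ (γ ⟨$⟩ʳ a)) αx₁≡x ⟩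
    β ⟨$⟩ˡ (γ ⟨$⟩ʳ x)            ≡⟨ cong (β ⟨$⟩ˡ_) (trans γx≡x (sym βy₁≡x)) ⟩
    β ⟨$⟩ˡ (β ⟨$⟩ʳ y₁)           ≡⟨ inverseˡ β ⟩
    y₁                            ∎
  maps₂ : β ⟨$⟩ˡ (γ ⟨$⟩ʳ (α ⟨$⟩ʳ x₂)) ≡ y₂
  maps₂ = trans (cong (β ⟨$⟩ˡ_) γαx₂≡βy₂) (inverseˡ β)

-- A point a ∉ {x, y} is sent to x by the stabilizer of y; the point y is sent to a
-- third point c by the stabilizer of x, and c then to x by the stabilizer of y.
InG-orbit-of-two-stabilizers : (Γ : SimpleGraph n) → 3 ≤ n → {x y : Fin n} → x ≢ y →
  AutTransitiveOff (localized Γ x) x → AutTransitiveOff (localized Γ y) y →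
  ∀ a → Σ (Permutation′ n) λ σ → InG Γ σ × σ ⟨$⟩ʳ a ≡ x
InG-orbit-of-two-stabilizers Γ 3≤n {x} {y} x≢y aut-x aut-y a with a ≟ x | a ≟ y
... | yes a≡x | _ = id , InG-id Γ , a≡x
... | no a≢x | no a≢y with aut-y a x a≢y x≢y
...   | σ , aut-σ , _ , σa≡x = σ , InAut-localized⇒InG Γ σ y aut-σ , σa≡x
InG-orbit-of-two-stabilizers Γ 3≤n {x} {y} x≢y aut-x aut-y a | no _ | yes refl
  with third-point 3≤n x y
... | c , c≢x , c≢y with aut-x y c (≢-sym x≢y) c≢x | aut-y c x c≢y x≢y
...   | σ , aut-σ , _ , σy≡c | τ , aut-τ , _ , τc≡x =
  σ ∘ₚ τ ,
  InG-∘ Γ σ τ (InAut-localized⇒InG Γ σ x aut-σ) (InAut-localized⇒InG Γ τ y aut-τ) ,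
  trans (cong (τ ⟨$⟩ʳ_) σy≡c) τc≡x

Aut-transitive⇒doublyTransitive : (Γ : SimpleGraph n) → 3 ≤ n → ∀ x y → x ≢ y →
  AutTransitiveOff (localized Γ x) x → AutTransitiveOff (localized Γ y) y →
  GDoublyTransitive Γ
Aut-transitive⇒doublyTransitive Γ 3≤n x y x≢y aut-x aut-y =
  doublyTransitive-by-stabilizer (InG Γ) (InG-∘ Γ) (InG-flip Γ) x
    (InG-orbit-of-two-stabilizers Γ 3≤n x≢y aut-x aut-y)
    λ y z y≢x z≢x → stabilizer (aut-x y z y≢x z≢x)
  where
  stabilizer : ∀ {y z} →
    Σ (Permutation′ _) (λ σ → InAut (localized Γ x) σ × σ ⟨$⟩ʳ x ≡ x × σ ⟨$⟩ʳ y ≡ z) →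
    Σ (Permutation′ _) (λ σ → InG Γ σ × σ ⟨$⟩ʳ x ≡ x × σ ⟨$⟩ʳ y ≡ z)
  stabilizer (σ , aut , σx≡x , σy≡z) = σ , InAut-localized⇒InG Γ σ x aut , σx≡x , σy≡z

proposition4 : (n : ℕ) → 3 ≤ n → (Γ : SimpleGraph n) →
    (GTransitive Γ ⇔ (∀ (x y : Fin n) → Isomorphic (localized Γ x) (localized Γ y)))
    × (GDoublyTransitive Γ → ∀ (x : Fin n) → AutTransitiveOff (localized Γ x) x)
    × (∀ (x y : Fin n) → ¬ x ≡ y →
         AutTransitiveOff (localized Γ x) x → AutTransitiveOff (localized Γ y) y →
         GDoublyTransitive Γ)
proposition4 n 3≤n Γ =
  mk⇔ (transitive⇒localized-isomorphic Γ) (localized-isomorphic⇒transitive Γ) ,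
  doublyTransitive⇒Aut-transitive Γ ,
  Aut-transitive⇒doublyTransitive Γ 3≤n
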